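{- (i) There is a normalized monotone subadditive set function $f$ over $[m]$ with $\mathrm{MPH}(f)\ge m/2$. (ii) There is a normalized monotone set function $f$ over $[m]$ with $f\in\mathrm{MPH}\text{ - }2$ whose superadditive width and supermodular width are both $m-1$.
   Context: A set function $f:2^{[m]}\to\mathbb{R}$ is normalized if $f(\emptyset)=0$, monotone if $f(S)\le f(T)$ for $S\subseteq T$, subadditive if $f(S\cup T)\le f(S)+f(T)$ for all $S,T$. Write $f(S\mid T)=f(S\cup T)-f(T)$, $f(v\mid T)=f(\{v\}\mid T)$. A set $T$ is supermodular w.r.t. $f$ if there exist $S\subseteq[m]$ and $v\in[m]\setminus T$ with $f(v\mid S\cup T)>\max_{T'\subsetneq T} f(v\mid S\cup T')$; the supermodular width is the maximum cardinality of a nonempty supermodular set (0 if none). A set $T$ is superadditive w.r.t. $f$ if there exists $S\subseteq[m]\setminus T$ with $f(S\mid T)>\max_{T'\subsetneq T} f(S\mid T')$; the superadditive width is the maximum cardinality of a nonempty superadditive set (0 if none). Every normalized $f$ has a unique representation $f(S)=\sum_{T\subseteq S}h(T)$. $\mathrm{PH}\text{ - }d$ is the class of $f$ with $h(T)\ge0$ for all $T$ and $h(T)>0$ only if $|T|\le d$. $\mathrm{MPH}\text{ - }d$ is the class of functions of the form $f(S)=\max_{i\in[k]}f_i(S)$ with $f_1,\dots,f_k\in\mathrm{PH}\text{ - }d$, and $\mathrm{MPH}(f)$ is the least $d$ with $f\in\mathrm{MPH}\text{ - }d$.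
   Formalization: All set functions, including the witnesses and the components $f_1,\dots,f_k$ of the decompositions ruled out in (i), take values in ℚ instead of ℝ. -}

module Defs where

open import Data.Nat as ℕ using (ℕ; zero; suc)
open import Data.Fin using (Fin)
open import Data.Fin.Subset
  using (Subset; ⊥; ⁅_⁆; _∈_; _∉_; _⊆_; _⊂_; _∪_; ∣_∣; Nonempty; inside; outside)
open import Data.Vec using ([]; _∷_)
open import Data.List using (List; []; _∷_; map; _++_; foldr)
open import Data.Rational using (ℚ; 0ℚ; _+_; _-_; _≤_; _<_)
open import Data.Product using (Σ; ∃; _×_; _,_)
open import Data.Sum using (_⊎_)
open import Relation.Binary.PropositionalEquality using (_≡_)

SetFn : ℕ → Set
SetFn m = Subset m → ℚ

marg : ∀ {m} → SetFn m → Subset m → Subset m → ℚ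
marg f S T = f (S ∪ T) - f T

margₑ : ∀ {m} → SetFn m → Fin m → Subset m → ℚ
margₑ f v T = marg f ⁅ v ⁆ T

Normalized : ∀ {m} → SetFn m → Set
Normalized f = f ⊥ ≡ 0ℚ

Monotone : ∀ {m} → SetFn m → Set
Monotone f = ∀ S T → S ⊆ T → f S ≤ f T

Subadditive : ∀ {m} → SetFn m → Set
Subadditive f = ∀ S T → f (S ∪ T) ≤ f S + f T

subsetsOf : ∀ {m} → Subset m → List (Subset m)
subsetsOf []             = [] ∷ []
subsetsOf (inside ∷ S)   = map (outside ∷_) (subsetsOf S) ++ map (inside ∷_) (subsetsOf S)
subsetsOf (outside ∷ S)  = map (outside ∷_) (subsetsOf S)

sumℚ : List ℚ → ℚ
sumℚ = foldr _+_ 0ℚ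

PH : ∀ {m} → ℕ → SetFn m → Set
PH {m} d f =
  Normalized f ×
  Σ (SetFn m) λ h →
    (∀ T → 0ℚ ≤ h T) ×
    (∀ T → 0ℚ < h T → ∣ T ∣ ℕ.≤ d) ×
    (∀ S → f S ≡ sumℚ (map h (subsetsOf S)))

-- MPH-d: f(S) = max_{i ∈ [k]} f_i(S) with each f_i ∈ PH-d
-- ("max" unfolded: every f_i(S) ≤ f(S) and some f_i(S) equals f(S))
MPH : ∀ {m} → ℕ → SetFn m → Set
MPH {m} d f =
  Σ ℕ λ k → Σ (Fin k → SetFn m) λ fs →
    (∀ i → PH d (fs i)) ×
    (∀ S → (∀ i → fs i S ≤ f S) × ∃ λ i → fs i S ≡ f S)

Supermodular : ∀ {m} → SetFn m → Subset m → Set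
Supermodular {m} f T =
  Σ (Subset m) λ S → Σ (Fin m) λ v → v ∉ T ×
    (∀ T' → T' ⊂ T → margₑ f v (S ∪ T') < margₑ f v (S ∪ T))

Superadditive : ∀ {m} → SetFn m → Subset m → Set
Superadditive {m} f T =
  Σ (Subset m) λ S → (∀ {x} → x ∈ S → x ∉ T) ×
    (∀ T' → T' ⊂ T → marg f S T' < marg f S T)

IsWidth : ∀ {m} → (Subset m → Set) → ℕ → Set
IsWidth {m} P w =
  (∀ T → Nonempty T → P T → ∣ T ∣ ℕ.≤ w) ×
  (w ≡ 0 ⊎ Σ (Subset m) λ T → Nonempty T × P T × ∣ T ∣ ≡ w)

SupermodularWidth : ∀ {m} → SetFn m → ℕ → Set
SupermodularWidth f = IsWidth (Supermodular f)

SuperadditiveWidth : ∀ {m} → SetFn m → ℕ → Set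
SuperadditiveWidth f = IsWidth (Superadditive f)

-- (i) Let f(S) be 0, 1 or 2 according as S is empty, a nonempty proper subset, or all of [m];
-- f is monotone and subadditive. If f is a maximum of PH-d functions, one of them,
-- g(S) = Σ_{T ⊆ S} h(T), has g([m]) = 2, while g ≤ f gives g([m] - v) ≤ 1 for every v. Double
-- counting gives Σ_v g([m] - v) + Σ_T |T| h(T) = m g([m]), and |T| ≤ d on the support of h bounds
-- the second sum by d g([m]); hence 2m ≤ m + 2d.
-- (ii) The star f(S) = [0 ∈ S] |S ∖ {0}| is PH-2, with weight 1 on each pair {0, j}. The marginal
-- value of 0 on T ⊆ [m] ∖ {0} is |T|, strictly increasing in T, so [m] ∖ {0} is supermodular
-- (S = ∅, v = 0) and superadditive (S = {0}); no larger set is either, since each such set misses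
-- an element.
module Submission where

open import Defs

-- ℚ's order is opened only inside this block, so that theorem7 below reads ≤ as ℕ's.
module _ where

  open import Algebra.Bundles using (CommutativeMonoid)
  open import Data.Bool using (if_then_else_)
  open import Data.Empty using (⊥-elim)
  open import Data.Fin using (Fin; zero; suc)
  open import Data.Fin.Subset
    using (Subset; ⊥; ⊤; ⁅_⁆; _∉_; _⊆_; _⊂_; _∪_; _-_; ∣_∣; Nonempty; inside; outside)
  open import Data.Fin.Subset.Properties
    using ( nonempty?; _⊆?_; Empty-unique; ∉⊥; ∈⊤; ⊥⊆; ⊆⊤; ⊆-trans; ∣⊤∣≡n
          ; drop-∷-⊆; drop-∷-⊂; p⊆q⇒∣p∣≤∣q∣; p⊂q⇒∣p∣<∣q∣; x∈⁅y⁆⇒x≡y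
          ; ∪-identityˡ; ∪-identityʳ; p─⊥≡p; x∈p⇒p-x⊂p)
  open import Data.List using (List; []; _∷_; map; _++_)
  open import Data.List.Properties using (map-++; map-∘)
  import Data.Nat as ℕ
  open ℕ using (ℕ; zero; suc; _∸_; z≤n; s≤s)
  import Data.Nat.Properties as ℕₚ
  open import Data.Nat.Combinatorics using (_C_; nC1≡n; nCk+nC[k+1]≡[n+1]C[k+1])
  open import Data.Product using (Σ; ∃; _×_; _,_; proj₁)
  open import Data.Rational using (ℚ; 0ℚ; 1ℚ; _+_; _≤_; _<_)
  open import Data.Rational.Properties
  open import Data.Rational.Solver using (module +-*-Solver)
  open import Data.Sum using (_⊎_; inj₁; inj₂)
  open import Data.Vec using ([]; _∷_; here; there)
  open import Function using (_∘_)
  open import Relation.Nullary using (Dec; yes; no; does; ¬_; contradiction)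
  open import Relation.Nullary.Decidable using (_×-dec_)
  open import Relation.Binary.PropositionalEquality

  open import Algebra.Properties.CommutativeMonoid.Sum +-0-commutativeMonoid
    using (sum; sum-syntax; ∑-distrib-+; sum-cong-≗; sum-replicate; sum-replicate-zero)
  open import Algebra.Properties.CommutativeMonoid.Mult +-0-commutativeMonoid
    using (×-homo-+; ×-distrib-+) renaming (_×_ to _·_)
  open import Algebra.Properties.CommutativeSemigroup
    (CommutativeMonoid.commutativeSemigroup +-0-commutativeMonoid) using (interchange)

  0<1 : 0ℚ < 1ℚ
  0<1 = positive⁻¹ 1ℚ

  0≤1 : 0ℚ ≤ 1ℚ
  0≤1 = <⇒≤ 0<1

  ·-zeroʳ : ∀ n → n · 0ℚ ≡ 0ℚ
  ·-zeroʳ n = trans (sym (sum-replicate n)) (sum-replicate-zero n)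

  ·-monoˡ-≤ : ∀ {x} → 0ℚ ≤ x → ∀ {m n} → m ℕ.≤ n → m · x ≤ n · x
  ·-monoˡ-≤ x≥0 {n = zero}  z≤n       = ≤-refl
  ·-monoˡ-≤ x≥0 {n = suc n} z≤n       = +-mono-≤ x≥0 (·-monoˡ-≤ x≥0 (z≤n {n}))
  ·-monoˡ-≤ {x} x≥0         (s≤s m≤n) = +-monoʳ-≤ x (·-monoˡ-≤ x≥0 m≤n)

  ·-monoˡ-< : ∀ {x} → 0ℚ < x → ∀ {m n} → m ℕ.< n → m · x < n · x
  ·-monoˡ-< x>0 {zero}  {suc n} _         = +-mono-<-≤ x>0 (·-monoˡ-≤ (<⇒≤ x>0) (z≤n {n}))
  ·-monoˡ-< {x} x>0 {suc m} {suc n} (s≤s m<n) = +-monoʳ-< x (·-monoˡ-< x>0 m<n)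

  ·-cancelʳ-≤ : ∀ {x} → 0ℚ < x → ∀ {m n} → m · x ≤ n · x → m ℕ.≤ n
  ·-cancelʳ-≤ x>0 {m} {n} le with m ℕ.≤? n
  ... | yes m≤n = m≤n
  ... | no  m≰n = ⊥-elim (<-irrefl refl (<-≤-trans (·-monoˡ-< x>0 (ℕₚ.≰⇒> m≰n)) le))

  sum-boundedBy : ∀ {n} {f : Fin n → ℚ} {x} → (∀ i → f i ≤ x) → sum f ≤ n · x
  sum-boundedBy {zero}  f≤x = ≤-refl
  sum-boundedBy {suc n} f≤x = +-mono-≤ (f≤x zero) (sum-boundedBy (f≤x ∘ suc))

  𝟙[_] : {P : Set} → Dec P → ℚ
  𝟙[ P? ] = if does P? then 1ℚ else 0ℚ

  module _ {P : Set} where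

    𝟙-nonneg : (P? : Dec P) → 0ℚ ≤ 𝟙[ P? ]
    𝟙-nonneg (yes _) = 0≤1
    𝟙-nonneg (no _)  = ≤-refl

    𝟙-≤1 : (P? : Dec P) → 𝟙[ P? ] ≤ 1ℚ
    𝟙-≤1 (yes _) = ≤-refl
    𝟙-≤1 (no _)  = 0≤1

    𝟙-yes : P → (P? : Dec P) → 𝟙[ P? ] ≡ 1ℚ
    𝟙-yes p (yes _) = refl
    𝟙-yes p (no ¬p) = contradiction p ¬p

    𝟙-no : ¬ P → (P? : Dec P) → 𝟙[ P? ] ≡ 0ℚ
    𝟙-no ¬p (yes p) = contradiction p ¬p
    𝟙-no ¬p (no _)  = refl

    𝟙-pos : (P? : Dec P) → 0ℚ < 𝟙[ P? ] → P
    𝟙-pos (yes p) _   = p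
    𝟙-pos (no _)  0<0 = ⊥-elim (<-irrefl refl 0<0)

  𝟙-mono : {P Q : Set} → (P → Q) → (P? : Dec P) (Q? : Dec Q) → 𝟙[ P? ] ≤ 𝟙[ Q? ]
  𝟙-mono P⇒Q (yes p) (yes _) = ≤-refl
  𝟙-mono P⇒Q (yes p) (no ¬q) = contradiction (P⇒Q p) ¬q
  𝟙-mono P⇒Q (no _)  Q?      = 𝟙-nonneg Q?

  sumℚ-++ : (xs ys : List ℚ) → sumℚ (xs ++ ys) ≡ sumℚ xs + sumℚ ys
  sumℚ-++ []       ys = sym (+-identityˡ _)
  sumℚ-++ (x ∷ xs) ys = trans (cong (x +_) (sumℚ-++ xs ys)) (sym (+-assoc x _ _))

  module _ {A : Set} where

    sumℚ-map-0 : (L : List A) → sumℚ (map (λ _ → 0ℚ) L) ≡ 0ℚ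
    sumℚ-map-0 []      = refl
    sumℚ-map-0 (_ ∷ L) = trans (+-identityˡ _) (sumℚ-map-0 L)

    sumℚ-map-+ : (f g : A → ℚ) (L : List A) →
                 sumℚ (map (λ a → f a + g a) L) ≡ sumℚ (map f L) + sumℚ (map g L)
    sumℚ-map-+ f g []      = sym (+-identityˡ 0ℚ)
    sumℚ-map-+ f g (a ∷ L) =
      trans (cong (f a + g a +_) (sumℚ-map-+ f g L)) (interchange (f a) (g a) _ _)

    sumℚ-map-mono-≤ : {f g : A → ℚ} → (∀ a → f a ≤ g a) → (L : List A) →
                      sumℚ (map f L) ≤ sumℚ (map g L)
    sumℚ-map-mono-≤ f≤g []      = ≤-refl
    sumℚ-map-mono-≤ f≤g (a ∷ L) = +-mono-≤ (f≤g a) (sumℚ-map-mono-≤ f≤g L)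

    ·-distrib-sumℚ : ∀ n (f : A → ℚ) (L : List A) →
                     n · sumℚ (map f L) ≡ sumℚ (map (λ a → n · f a) L)
    ·-distrib-sumℚ n f []      = ·-zeroʳ n
    ·-distrib-sumℚ n f (a ∷ L) =
      trans (×-distrib-+ (f a) _ n) (cong (n · f a +_) (·-distrib-sumℚ n f L))

  Σ⊆ : ∀ {m} → (Subset m → ℚ) → Subset m → ℚ
  Σ⊆ h S = sumℚ (map h (subsetsOf S))

  Σ⊆-outside : ∀ {m} (h : Subset (suc m) → ℚ) S → Σ⊆ h (outside ∷ S) ≡ Σ⊆ (h ∘ (outside ∷_)) S
  Σ⊆-outside h S = cong sumℚ (sym (map-∘ (subsetsOf S)))

  Σ⊆-inside : ∀ {m} (h : Subset (suc m) → ℚ) S →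
              Σ⊆ h (inside ∷ S) ≡ Σ⊆ (h ∘ (outside ∷_)) S + Σ⊆ (h ∘ (inside ∷_)) S
  Σ⊆-inside h S = begin
    sumℚ (map h (map (outside ∷_) Ss ++ map (inside ∷_) Ss))
      ≡⟨ cong sumℚ (map-++ h (map (outside ∷_) Ss) (map (inside ∷_) Ss)) ⟩
    sumℚ (map h (map (outside ∷_) Ss) ++ map h (map (inside ∷_) Ss))
      ≡⟨ sumℚ-++ (map h (map (outside ∷_) Ss)) (map h (map (inside ∷_) Ss)) ⟩
    sumℚ (map h (map (outside ∷_) Ss)) + sumℚ (map h (map (inside ∷_) Ss))
      ≡⟨ sym (cong₂ _+_ (cong sumℚ (map-∘ Ss)) (cong sumℚ (map-∘ Ss))) ⟩
    Σ⊆ (h ∘ (outside ∷_)) S + Σ⊆ (h ∘ (inside ∷_)) S ∎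
    where
    open ≡-Reasoning
    Ss = subsetsOf S

  Σ⊆-𝟙-size : ∀ k {m} (S : Subset m) → Σ⊆ (λ U → 𝟙[ ∣ U ∣ ℕₚ.≟ k ]) S ≡ (∣ S ∣ C k) · 1ℚ
  Σ⊆-𝟙-size zero    []            = refl
  Σ⊆-𝟙-size (suc k) []            = +-identityʳ 0ℚ
  Σ⊆-𝟙-size k       (outside ∷ S) = trans (Σ⊆-outside _ S) (Σ⊆-𝟙-size k S)
  Σ⊆-𝟙-size zero    (inside ∷ S)  = begin
    Σ⊆ (λ U → 𝟙[ ∣ U ∣ ℕₚ.≟ 0 ]) (inside ∷ S)         ≡⟨ Σ⊆-inside _ S ⟩
    Σ⊆ (λ U → 𝟙[ ∣ U ∣ ℕₚ.≟ 0 ]) S + Σ⊆ (λ _ → 0ℚ) S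
      ≡⟨ cong₂ _+_ (Σ⊆-𝟙-size 0 S) (sumℚ-map-0 (subsetsOf S)) ⟩
    (∣ S ∣ C 0) · 1ℚ + 0ℚ                          ≡⟨ +-identityʳ _ ⟩
    (suc ∣ S ∣ C 0) · 1ℚ                           ∎
    where open ≡-Reasoning
  Σ⊆-𝟙-size (suc k) (inside ∷ S)  = begin
    Σ⊆ (λ U → 𝟙[ ∣ U ∣ ℕₚ.≟ suc k ]) (inside ∷ S)
      ≡⟨ Σ⊆-inside _ S ⟩
    Σ⊆ (λ U → 𝟙[ ∣ U ∣ ℕₚ.≟ suc k ]) S + Σ⊆ (λ U → 𝟙[ ∣ U ∣ ℕₚ.≟ k ]) S
      ≡⟨ cong₂ _+_ (Σ⊆-𝟙-size (suc k) S) (Σ⊆-𝟙-size k S) ⟩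
    (∣ S ∣ C suc k) · 1ℚ + (∣ S ∣ C k) · 1ℚ
      ≡⟨ sym (×-homo-+ 1ℚ (∣ S ∣ C suc k) (∣ S ∣ C k)) ⟩
    (∣ S ∣ C suc k ℕ.+ ∣ S ∣ C k) · 1ℚ
      ≡⟨ cong (_· 1ℚ) (ℕₚ.+-comm (∣ S ∣ C suc k) (∣ S ∣ C k)) ⟩
    (∣ S ∣ C k ℕ.+ ∣ S ∣ C suc k) · 1ℚ
      ≡⟨ cong (_· 1ℚ) (nCk+nC[k+1]≡[n+1]C[k+1] ∣ S ∣ k) ⟩
    (suc ∣ S ∣ C suc k) · 1ℚ ∎
    where open ≡-Reasoning

  Σ⊆-size-weighted-≤ : ∀ {m d} {h : Subset m → ℚ} → (∀ T → 0ℚ ≤ h T) →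
                       (∀ T → 0ℚ < h T → ∣ T ∣ ℕ.≤ d) →
                       ∀ S → Σ⊆ (λ U → ∣ U ∣ · h U) S ≤ d · Σ⊆ h S
  Σ⊆-size-weighted-≤ {d = d} {h} h≥0 supp S =
    subst (Σ⊆ (λ U → ∣ U ∣ · h U) S ≤_) (sym (·-distrib-sumℚ d h (subsetsOf S)))
      (sumℚ-map-mono-≤ weight≤d (subsetsOf S))
    where
    weight≤d : ∀ U → ∣ U ∣ · h U ≤ d · h U
    weight≤d U with 0ℚ <? h U
    ... | yes hU>0 = ·-monoˡ-≤ (h≥0 U) (supp U hU>0)
    ... | no  hU≯0 = subst (λ y → ∣ U ∣ · y ≤ d · y) (sym (≤-antisym (≮⇒≥ hU≯0) (h≥0 U)))
                       (≤-reflexive (trans (·-zeroʳ ∣ U ∣) (sym (·-zeroʳ d))))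

  -- Each U ⊆ [m] lies in m − |U| of the coatoms ⊤ - v and is counted |U| times by the weight.
  Σ⊆-double-count : ∀ m (h : Subset m → ℚ) →
    ∑[ v < m ] Σ⊆ h (⊤ - v) + Σ⊆ (λ U → ∣ U ∣ · h U) ⊤ ≡ m · Σ⊆ h ⊤
  Σ⊆-double-count zero    h = refl
  Σ⊆-double-count (suc m) h = begin
    ∑[ v < suc m ] Σ⊆ h (⊤ - v) + W h
      ≡⟨ cong₂ (λ a b → a + b + W h) complement-zero complement-suc ⟩
    G₀ + (S₀ + S₁) + W h
      ≡⟨ cong (G₀ + (S₀ + S₁) +_) weights ⟩
    G₀ + (S₀ + S₁) + (W h₀ + (G₁ + W h₁))
      ≡⟨ regroup G₀ S₀ S₁ (W h₀) G₁ (W h₁) ⟩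
    (G₀ + G₁) + ((S₀ + W h₀) + (S₁ + W h₁))
      ≡⟨ cong₂ (λ a b → (G₀ + G₁) + (a + b)) (Σ⊆-double-count m h₀) (Σ⊆-double-count m h₁) ⟩
    (G₀ + G₁) + (m · G₀ + m · G₁)
      ≡⟨ cong ((G₀ + G₁) +_) (sym (×-distrib-+ G₀ G₁ m)) ⟩
    (G₀ + G₁) + m · (G₀ + G₁)
      ≡⟨ cong (λ x → x + m · x) (sym (Σ⊆-inside h ⊤)) ⟩
    suc m · Σ⊆ h ⊤ ∎
    where
    open ≡-Reasoning
    W : ∀ {n} → (Subset n → ℚ) → ℚ
    W g = Σ⊆ (λ U → ∣ U ∣ · g U) ⊤
    h₀ h₁ : Subset m → ℚ
    h₀ = h ∘ (outside ∷_)
    h₁ = h ∘ (inside ∷_)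
    G₀ = Σ⊆ h₀ ⊤
    G₁ = Σ⊆ h₁ ⊤
    S₀ = ∑[ v < m ] Σ⊆ h₀ (⊤ - v)
    S₁ = ∑[ v < m ] Σ⊆ h₁ (⊤ - v)
    complement-zero : Σ⊆ h (⊤ - zero) ≡ G₀
    complement-zero = trans (cong (λ X → Σ⊆ h (outside ∷ X)) (p─⊥≡p ⊤)) (Σ⊆-outside h ⊤)
    complement-suc : ∑[ v < m ] Σ⊆ h (⊤ - suc v) ≡ S₀ + S₁
    complement-suc = trans (sum-cong-≗ (λ v → Σ⊆-inside h (⊤ - v)))
                           (∑-distrib-+ (λ v → Σ⊆ h₀ (⊤ - v)) (λ v → Σ⊆ h₁ (⊤ - v)))
    weights : W h ≡ W h₀ + (G₁ + W h₁)
    weights = trans (Σ⊆-inside (λ U → ∣ U ∣ · h U) ⊤)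
                    (cong (W h₀ +_) (sumℚ-map-+ h₁ (λ U → ∣ U ∣ · h₁ U) (subsetsOf ⊤)))
    regroup : ∀ a b c d e f → a + (b + c) + (d + (e + f)) ≡ (a + e) + ((b + d) + (c + f))
    regroup = solve 6 (λ a b c d e f → a :+ (b :+ c) :+ (d :+ (e :+ f))
                                       := (a :+ e) :+ ((b :+ d) :+ (c :+ f))) refl
      where open +-*-Solver

  PH-coatom-bound : ∀ {m d} {g : SetFn m} → PH d g → m · g ⊤ ≤ ∑[ v < m ] g (⊤ - v) + d · g ⊤
  PH-coatom-bound {m} {d} {g} (_ , h , h≥0 , supp , g≡Σ⊆h) = begin
    m · g ⊤
      ≡⟨ cong (m ·_) (g≡Σ⊆h ⊤) ⟩
    m · Σ⊆ h ⊤
      ≡⟨ sym (Σ⊆-double-count m h) ⟩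
    ∑[ v < m ] Σ⊆ h (⊤ - v) + Σ⊆ (λ U → ∣ U ∣ · h U) ⊤
      ≤⟨ +-monoʳ-≤ (∑[ v < m ] Σ⊆ h (⊤ - v)) (Σ⊆-size-weighted-≤ h≥0 supp ⊤) ⟩
    ∑[ v < m ] Σ⊆ h (⊤ - v) + d · Σ⊆ h ⊤
      ≡⟨ sym (cong₂ (λ a b → a + d · b) (sum-cong-≗ (λ v → g≡Σ⊆h (⊤ - v))) (g≡Σ⊆h ⊤)) ⟩
    ∑[ v < m ] g (⊤ - v) + d · g ⊤ ∎
    where open ≤-Reasoning

  PH⇒MPH : ∀ {m d} {f : SetFn m} → PH d f → MPH d f
  PH⇒MPH f∈PH = 1 , (λ _ → _) , (λ _ → f∈PH) , (λ S → (λ _ → ≤-refl) , zero , refl)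

  ∉⇒∣p∣≤n∸1 : ∀ {n} {p : Subset n} {x} → x ∉ p → ∣ p ∣ ℕ.≤ n ∸ 1
  ∉⇒∣p∣≤n∸1 {n} {p} {x} x∉p =
    ℕₚ.pred-mono-≤ (subst (∣ p ∣ ℕ.<_) (∣⊤∣≡n n) (p⊂q⇒∣p∣<∣q∣ (⊆⊤ , x , ∈⊤ , x∉p)))

  IsWidth-coatom : {P : ∀ {n} → Subset n → Set} →
                   (∀ {n} (T : Subset n) → Nonempty T → P T → ∃ λ x → x ∉ T) →
                   (∀ {n} → P (outside ∷ ⊤ {suc n})) →
                   ∀ m → IsWidth (P {m}) (m ∸ 1)
  IsWidth-coatom {P} proper coatom m = bound , witness m
    where
    bound : ∀ T → Nonempty T → P T → ∣ T ∣ ℕ.≤ m ∸ 1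
    bound T T≠∅ PT = let (x , x∉T) = proper T T≠∅ PT in ∉⇒∣p∣≤n∸1 x∉T
    witness : ∀ k → k ∸ 1 ≡ 0 ⊎ Σ (Subset k) λ T → Nonempty T × P T × ∣ T ∣ ≡ k ∸ 1
    witness zero          = inj₁ refl
    witness (suc zero)    = inj₁ refl
    witness (suc (suc n)) = inj₂ (outside ∷ ⊤ , (suc zero , there here) , coatom , ∣⊤∣≡n (suc n))

  Superadditive⇒proper : ∀ {m} (f : SetFn m) T → Nonempty T → Superadditive f T → ∃ λ x → x ∉ T
  Superadditive⇒proper f T (x , x∈T) (S , S∩T=∅ , growth) with nonempty? S
  ... | yes (y , y∈S) = y , S∩T=∅ y∈S
  ... | no  S=∅       = ⊥-elim (<-irrefl (trans (marg-∅ ⊥) (sym (marg-∅ T)))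
                                          (growth ⊥ (⊥⊆ , x , x∈T , ∉⊥)))
    where
    marg-∅ : ∀ X → marg f S X ≡ 0ℚ
    marg-∅ X rewrite Empty-unique S=∅ | ∪-identityˡ X = +-inverseʳ (f X)

  subadditive-⊥ˡ : ∀ {m} {f : SetFn m} → Normalized f → ∀ T → f (⊥ ∪ T) ≤ f ⊥ + f T
  subadditive-⊥ˡ {f = f} f⊥≡0 T = ≤-reflexive (begin
    f (⊥ ∪ T)   ≡⟨ cong f (∪-identityˡ T) ⟩
    f T         ≡⟨ sym (+-identityˡ (f T)) ⟩
    0ℚ + f T    ≡⟨ cong (_+ f T) (sym f⊥≡0) ⟩
    f ⊥ + f T   ∎)
    where open ≡-Reasoning

  subadditive-⊥ʳ : ∀ {m} {f : SetFn m} → Normalized f → ∀ S → f (S ∪ ⊥) ≤ f S + f ⊥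
  subadditive-⊥ʳ {f = f} f⊥≡0 S = ≤-reflexive (begin
    f (S ∪ ⊥)   ≡⟨ cong f (∪-identityʳ S) ⟩
    f S         ≡⟨ sym (+-identityʳ (f S)) ⟩
    f S + 0ℚ    ≡⟨ cong (f S +_) (sym f⊥≡0) ⟩
    f S + f ⊥   ∎)
    where open ≡-Reasoning

  nonempty-full? : ∀ {m} (S : Subset m) → Dec (Nonempty S × ⊤ ⊆ S)
  nonempty-full? S = nonempty? S ×-dec ⊤ ⊆? S

  nonempty+full : ∀ {m} → SetFn m
  nonempty+full S = 𝟙[ nonempty? S ] + 𝟙[ nonempty-full? S ]

  nonempty+full-normalized : ∀ {m} → Normalized (nonempty+full {m})
  nonempty+full-normalized {m} =
    trans (cong₂ _+_ (𝟙-no ⊥-empty (nonempty? ⊥)) (𝟙-no (⊥-empty ∘ proj₁) (nonempty-full? ⊥)))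
          (+-identityʳ 0ℚ)
    where
    ⊥-empty : ¬ Nonempty (⊥ {m})
    ⊥-empty (_ , x∈⊥) = ∉⊥ x∈⊥

  nonempty+full-≤2 : ∀ {m} (S : Subset m) → nonempty+full S ≤ 1ℚ + 1ℚ
  nonempty+full-≤2 S = +-mono-≤ (𝟙-≤1 (nonempty? S)) (𝟙-≤1 (nonempty-full? S))

  nonempty+full-≥1 : ∀ {m} {S : Subset m} → Nonempty S → 1ℚ ≤ nonempty+full S
  nonempty+full-≥1 {S = S} S≠∅ =
    subst (_≤ nonempty+full S) (+-identityʳ 1ℚ)
      (+-mono-≤ (≤-reflexive (sym (𝟙-yes S≠∅ (nonempty? S)))) (𝟙-nonneg (nonempty-full? S)))

  nonempty+full-⊤ : ∀ {m} → Nonempty (⊤ {m}) → nonempty+full (⊤ {m}) ≡ 1ℚ + 1ℚ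
  nonempty+full-⊤ ⊤≠∅ =
    cong₂ _+_ (𝟙-yes ⊤≠∅ (nonempty? ⊤)) (𝟙-yes (⊤≠∅ , λ {_} → ⊆⊤) (nonempty-full? ⊤))

  nonempty+full-proper : ∀ {m} {S : Subset m} → S ⊂ ⊤ → nonempty+full S ≤ 1ℚ
  nonempty+full-proper {S = S} (_ , x , _ , x∉S) =
    subst (nonempty+full S ≤_) (+-identityʳ 1ℚ)
      (+-mono-≤ (𝟙-≤1 (nonempty? S))
                (≤-reflexive (𝟙-no (λ (_ , ⊤⊆S) → x∉S (⊤⊆S ∈⊤)) (nonempty-full? S))))

  nonempty+full-monotone : ∀ {m} → Monotone (nonempty+full {m})
  nonempty+full-monotone S T S⊆T =
    +-mono-≤ (𝟙-mono grow (nonempty? S) (nonempty? T))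
             (𝟙-mono (λ (S≠∅ , ⊤⊆S) → grow S≠∅ , λ {_} → ⊆-trans ⊤⊆S S⊆T)
                     (nonempty-full? S) (nonempty-full? T))
    where
    grow : Nonempty S → Nonempty T
    grow (x , x∈S) = x , S⊆T x∈S

  nonempty+full-subadditive : ∀ {m} → Subadditive (nonempty+full {m})
  nonempty+full-subadditive {m} S T = by-emptiness (nonempty? S) (nonempty? T)
    where
    f = nonempty+full {m}
    by-emptiness : Dec (Nonempty S) → Dec (Nonempty T) → f (S ∪ T) ≤ f S + f T
    by-emptiness (no S=∅) _ =
      subst (λ X → f (X ∪ T) ≤ f X + f T) (sym (Empty-unique S=∅))
        (subadditive-⊥ˡ {f = f} (nonempty+full-normalized {m}) T)
    by-emptiness _ (no T=∅) =
      subst (λ X → f (S ∪ X) ≤ f S + f X) (sym (Empty-unique T=∅))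
        (subadditive-⊥ʳ {f = f} (nonempty+full-normalized {m}) S)
    by-emptiness (yes S≠∅) (yes T≠∅) =
      ≤-trans (nonempty+full-≤2 (S ∪ T)) (+-mono-≤ (nonempty+full-≥1 S≠∅) (nonempty+full-≥1 T≠∅))

  nonempty+full-MPH : ∀ {m} d → MPH d (nonempty+full {m}) → m ℕ.≤ 2 ℕ.* d
  nonempty+full-MPH {zero}  d _ = z≤n
  nonempty+full-MPH {suc n} d (_ , gs , gs∈PH , gs-max) with gs-max ⊤
  ... | _ , i , gᵢ⊤≡f⊤ =
    subst (m ℕ.≤_) (cong (d ℕ.+_) (sym (ℕₚ.+-identityʳ d)))
      (ℕₚ.+-cancelˡ-≤ m m (d ℕ.+ d) (·-cancelʳ-≤ 0<1 counting))
    where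
    m = suc n
    g = gs i
    g⊤ : g ⊤ ≡ 1ℚ + 1ℚ
    g⊤ = trans gᵢ⊤≡f⊤ (nonempty+full-⊤ {m} (zero , here))
    g-coatom : ∀ v → g (⊤ - v) ≤ 1ℚ
    g-coatom v =
      ≤-trans (proj₁ (gs-max (⊤ - v)) i) (nonempty+full-proper (x∈p⇒p-x⊂p {x = v} ∈⊤))
    counting : (m ℕ.+ m) · 1ℚ ≤ (m ℕ.+ (d ℕ.+ d)) · 1ℚ
    counting = begin
      (m ℕ.+ m) · 1ℚ                  ≡⟨ ×-homo-+ 1ℚ m m ⟩
      m · 1ℚ + m · 1ℚ                 ≡⟨ sym (×-distrib-+ 1ℚ 1ℚ m) ⟩
      m · (1ℚ + 1ℚ)                   ≡⟨ cong (m ·_) (sym g⊤) ⟩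
      m · g ⊤                         ≤⟨ PH-coatom-bound (gs∈PH i) ⟩
      ∑[ v < m ] g (⊤ - v) + d · g ⊤  ≤⟨ +-mono-≤ (sum-boundedBy g-coatom)
                                                   (≤-reflexive (cong (d ·_) g⊤)) ⟩
      m · 1ℚ + d · (1ℚ + 1ℚ)          ≡⟨ cong (m · 1ℚ +_) (×-distrib-+ 1ℚ 1ℚ d) ⟩
      m · 1ℚ + (d · 1ℚ + d · 1ℚ)      ≡⟨ cong (m · 1ℚ +_) (sym (×-homo-+ 1ℚ d d)) ⟩
      m · 1ℚ + (d ℕ.+ d) · 1ℚ         ≡⟨ sym (×-homo-+ 1ℚ m (d ℕ.+ d)) ⟩
      (m ℕ.+ (d ℕ.+ d)) · 1ℚ          ∎
      where open ≤-Reasoning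

  star : ∀ {m} → SetFn m
  star []            = 0ℚ
  star (outside ∷ _) = 0ℚ
  star (inside ∷ S)  = ∣ S ∣ · 1ℚ

  starEdge : ∀ {m} → Subset m → ℚ
  starEdge []            = 0ℚ
  starEdge (outside ∷ _) = 0ℚ
  starEdge (inside ∷ U)  = 𝟙[ ∣ U ∣ ℕₚ.≟ 1 ]

  star≡Σ⊆starEdge : ∀ {m} (S : Subset m) → star S ≡ Σ⊆ starEdge S
  star≡Σ⊆starEdge []            = refl
  star≡Σ⊆starEdge (outside ∷ S) = sym (trans (Σ⊆-outside starEdge S) (sumℚ-map-0 (subsetsOf S)))
  star≡Σ⊆starEdge (inside ∷ S)  = sym (begin
    Σ⊆ starEdge (inside ∷ S)                              ≡⟨ Σ⊆-inside starEdge S ⟩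
    Σ⊆ (λ _ → 0ℚ) S + Σ⊆ (λ U → 𝟙[ ∣ U ∣ ℕₚ.≟ 1 ]) S
      ≡⟨ cong₂ _+_ (sumℚ-map-0 (subsetsOf S)) (Σ⊆-𝟙-size 1 S) ⟩
    0ℚ + (∣ S ∣ C 1) · 1ℚ                                 ≡⟨ +-identityˡ _ ⟩
    (∣ S ∣ C 1) · 1ℚ                                      ≡⟨ cong (_· 1ℚ) (nC1≡n ∣ S ∣) ⟩
    ∣ S ∣ · 1ℚ                                            ∎)
    where open ≡-Reasoning

  starEdge-nonneg : ∀ {m} (T : Subset m) → 0ℚ ≤ starEdge T
  starEdge-nonneg []            = ≤-refl
  starEdge-nonneg (outside ∷ _) = ≤-refl
  starEdge-nonneg (inside ∷ U)  = 𝟙-nonneg (∣ U ∣ ℕₚ.≟ 1)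

  starEdge-support : ∀ {m} (T : Subset m) → 0ℚ < starEdge T → ∣ T ∣ ℕ.≤ 2
  starEdge-support []            0<0 = ⊥-elim (<-irrefl refl 0<0)
  starEdge-support (outside ∷ _) 0<0 = ⊥-elim (<-irrefl refl 0<0)
  starEdge-support (inside ∷ U)  pos = s≤s (ℕₚ.≤-reflexive (𝟙-pos (∣ U ∣ ℕₚ.≟ 1) pos))

  star-normalized : ∀ {m} → Normalized (star {m})
  star-normalized {zero}  = refl
  star-normalized {suc m} = refl

  star∈PH-2 : ∀ {m} → PH 2 (star {m})
  star∈PH-2 {m} =
    star-normalized {m} , starEdge , starEdge-nonneg , starEdge-support , star≡Σ⊆starEdge

  star-nonneg : ∀ {m} (S : Subset m) → 0ℚ ≤ star S
  star-nonneg []            = ≤-refl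
  star-nonneg (outside ∷ _) = ≤-refl
  star-nonneg (inside ∷ S)  = ·-monoˡ-≤ 0≤1 (z≤n {∣ S ∣})

  star-monotone : ∀ {m} → Monotone (star {m})
  star-monotone []            []            _   = ≤-refl
  star-monotone (outside ∷ S) T             _   = star-nonneg T
  star-monotone (inside ∷ S)  (inside ∷ T)  S⊆T = ·-monoˡ-≤ 0≤1 (p⊆q⇒∣p∣≤∣q∣ (drop-∷-⊆ S⊆T))
  star-monotone (inside ∷ S)  (outside ∷ T) S⊆T = contradiction (S⊆T here) λ ()

  star-marginal-centre : ∀ {n} (U : Subset n) → margₑ star zero (outside ∷ U) ≡ ∣ U ∣ · 1ℚ
  star-marginal-centre U = trans (+-identityʳ _) (cong (λ X → ∣ X ∣ · 1ℚ) (∪-identityˡ U))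

  star-coatom-growth : ∀ {n} T → T ⊂ outside ∷ ⊤ {n} →
                       margₑ star zero T < margₑ star zero (outside ∷ ⊤ {n})
  star-coatom-growth     (inside ∷ U)  (T⊆ , _) = contradiction (T⊆ here) λ ()
  star-coatom-growth {n} (outside ∷ U) T⊂ =
    subst₂ _<_ (sym (star-marginal-centre U)) (sym (star-marginal-centre (⊤ {n})))
      (·-monoˡ-< 0<1 (p⊂q⇒∣p∣<∣q∣ (drop-∷-⊂ T⊂)))

  star-coatom-superadditive : ∀ {n} → Superadditive star (outside ∷ ⊤ {n})
  star-coatom-superadditive =
    ⁅ zero ⁆ , (λ x∈⁅0⁆ → subst (_∉ outside ∷ ⊤) (sym (x∈⁅y⁆⇒x≡y zero x∈⁅0⁆)) λ ())
             , star-coatom-growth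

  star-coatom-supermodular : ∀ {n} → Supermodular star (outside ∷ ⊤ {n})
  star-coatom-supermodular {n} =
    ⊥ , zero , (λ ()) , λ T T⊂ →
      subst₂ _<_ (cong (margₑ star zero) (sym (∪-identityˡ T)))
                 (cong (margₑ star zero) (sym (∪-identityˡ (outside ∷ ⊤ {n}))))
                 (star-coatom-growth T T⊂)

open import Data.Nat using (ℕ; _≤_; _*_; _∸_)
open import Data.Product using (Σ; _×_; _,_)

theorem7 :
    ((m : ℕ) → Σ (SetFn m) λ f →
        Normalized f × Monotone f × Subadditive f ×
        ((d : ℕ) → MPH d f → m ≤ 2 * d))
    ×
    ((m : ℕ) → Σ (SetFn m) λ f →
        Normalized f × Monotone f × MPH 2 f ×
        SuperadditiveWidth f (m ∸ 1) × SupermodularWidth f (m ∸ 1))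
theorem7 =
  (λ m → nonempty+full , nonempty+full-normalized {m} , nonempty+full-monotone
       , nonempty+full-subadditive , nonempty+full-MPH)
  ,
  (λ m → star , star-normalized {m} , star-monotone , PH⇒MPH star∈PH-2
       , IsWidth-coatom {λ {n} → Superadditive (star {n})} (Superadditive⇒proper star)
           star-coatom-superadditive m
       , IsWidth-coatom {λ {n} → Supermodular (star {n})} (λ _ _ (_ , v , v∉T , _) → v , v∉T)
           star-coatom-supermodular m)
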